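{- For $n\ge1$ let $C_n(t)=\sum_{w\in\{0,1\}^n}t^{\mathrm{des}(\mathrm{runsort}(w))}$. Then \[ C_n(t)=\binom{n+1}{3}+(n+1)+\sum_{k=2}^{n}t^{k-1}\left(\binom{n}{2k}+\binom{n}{2k+1}\right). \] In particular, the number of binary words of length $n$ with no descents after run-sorting is $\binom{n+1}{3}+n+1$.
   Context: For a word $w=w(1)\dotsm w(n)$ over $\{0,1\}$, $k\in[n-1]$ is a descent if $w(k)>w(k+1)$ and $\mathrm{des}(w)$ is the number of descents. The runs of $w$ are its maximal weakly increasing contiguous subwords, and $\mathrm{runsort}(w)$ is the word obtained by rearranging the runs of $w$ in lexicographic order. Binomial coefficients $\binom{n}{j}$ are $0$ for $j>n$. -}

module Defs where

open import Data.Bool using (Bool; true; false; if_then_else_; _∧_; not)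
open import Data.Nat using (ℕ; zero; suc; _+_; _*_; _∸_; _^_)
open import Data.List using (List; []; _∷_; _++_; map; concat; upTo)
open import Data.Nat.ListAction using (sum)

-- Binary words over {0,1}: false = 0, true = 1.
Word : Set
Word = List Bool

allWords : ℕ → List Word
allWords zero = [] ∷ []
allWords (suc n) = map (false ∷_) (allWords n) ++ map (true ∷_) (allWords n)

gtB : Bool → Bool → Bool
gtB x y = x ∧ not y

des : Word → ℕ
des [] = 0
des (x ∷ []) = 0
des (x ∷ y ∷ w) = (if gtB x y then 1 else 0) + des (y ∷ w)

-- Runs: maximal weakly increasing contiguous subwords (in order).
attach : Bool → Word → List Word → List Word
attach x [] _ = (x ∷ []) ∷ []
attach x (y ∷ _) [] = (x ∷ []) ∷ []
attach x (y ∷ _) (r ∷ rs) = if gtB x y then (x ∷ []) ∷ r ∷ rs else (x ∷ r) ∷ rs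

runs : Word → List Word
runs [] = []
runs (x ∷ w) = attach x w (runs w)

lexLeq : Word → Word → Bool
lexLeq [] _ = true
lexLeq (x ∷ u) [] = false
lexLeq (false ∷ u) (true ∷ v) = true
lexLeq (true ∷ u) (false ∷ v) = false
lexLeq (false ∷ u) (false ∷ v) = lexLeq u v
lexLeq (true ∷ u) (true ∷ v) = lexLeq u v

insertLex : Word → List Word → List Word
insertLex u [] = u ∷ []
insertLex u (v ∷ vs) = if lexLeq u v then u ∷ v ∷ vs else v ∷ insertLex u vs

sortLex : List Word → List Word
sortLex [] = []
sortLex (u ∷ us) = insertLex u (sortLex us)

runsort : Word → Word
runsort w = concat (sortLex (runs w))

Cpoly : ℕ → ℕ → ℕ
Cpoly n t = sum (map (λ w → t ^ des (runsort w)) (allWords n))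

-- The list [a, a+1, ..., b] (empty if b < a).
range : ℕ → ℕ → List ℕ
range a b = map (a +_) (upTo (suc b ∸ a))

module Submission where

-- Every run of a binary word has the form 0ᵃ, 0ᵃ1ᵇ or 1ᵇ (a, b ≥ 1), and lexicographically
-- 0ᵃ < 0ᶜ1ᵈ < 1ᵇ. So runsort(w) lists the pure-0 runs, then the mixed runs, then the pure-1 runs,
-- and its descents are exactly the boundaries between consecutive mixed runs: with asc(w) the
-- number of factors 01 in w (one per mixed run), des(runsort w) = asc(w) ∸ 1. Among the words of
-- length n, asc = j occurs C(n+1, 2j+1) times (and C(n+1, 2j) times among those starting with 0),
-- by Pascal's rule and induction on n. The count of words without descents is the value at t = 0.

open import Defs
open import Data.Nat using (ℕ; zero; suc; _+_; _*_; _∸_; _^_; _≥_)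
open import Data.Nat.Combinatorics using (_C_)
open import Data.List using (List; map; length; filter)
open import Data.Nat.ListAction using (sum)
open import Data.Product using (_×_)
open import Relation.Binary.PropositionalEquality using (_≡_)
open import Data.Nat using (_≟_)

open import Data.Nat.Properties
  using (+-assoc; +-comm; +-identityʳ; *-identityˡ; *-identityʳ; *-zeroʳ; *-suc; *-distribˡ-+; m<m+n; +-commutativeSemigroup)
open import Algebra.Properties.CommutativeSemigroup +-commutativeSemigroup
  using (interchange; x∙yz≈y∙xz)
open import Data.Bool using (Bool; true; false)
open import Data.List using ([]; _∷_; _++_; concat; applyUpTo)
open import Data.List.Properties using (map-++; map-∘; map-cong; map-upTo; map-applyUpTo)
open import Data.Nat using (s≤s; z≤n)
open import Data.Nat.Combinatorics using (k>n⇒nCk≡0; nCk+nC[k+1]≡[n+1]C[k+1]; nC1≡n)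
open import Data.Nat.ListAction.Properties using (sum-++)
open import Data.Product using (_,_)
open import Data.Sum using (_⊎_; inj₁; inj₂)
open import Function using (_∘_)
open import Relation.Binary.Construct.Closure.Reflexive using (ReflClosure; refl; [_])
import Relation.Binary.Construct.Closure.Reflexive.Properties as ReflClosure
open import Relation.Binary.PropositionalEquality using (refl; sym; trans; cong; cong₂; subst; _≗_; module ≡-Reasoning)

private
  variable
    A : Set
    x y : Bool
    m : ℕ
    u w : Word
    us L : List Word

ascent : Bool → Bool → ℕ
ascent false true  = 1
ascent false false = 0
ascent true  _     = 0

asc : Word → ℕ
asc []          = 0
asc (x ∷ [])    = 0
asc (x ∷ y ∷ w) = ascent x y + asc (y ∷ w)

asc-true∷ : ∀ w → asc (true ∷ w) ≡ asc w
asc-true∷ []      = refl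
asc-true∷ (y ∷ w) = refl

data Kind : Set where
  zeros mixed ones : Kind

data _<ₖ_ : Kind → Kind → Set where
  zeros<mixed : zeros <ₖ mixed
  zeros<ones  : zeros <ₖ ones
  mixed<ones  : mixed <ₖ ones

_≤ₖ_ : Kind → Kind → Set
_≤ₖ_ = ReflClosure _<ₖ_

private
  variable
    i j k : Kind

compareₖ : ∀ j k → j <ₖ k ⊎ j ≡ k ⊎ k <ₖ j
compareₖ zeros zeros = inj₂ (inj₁ refl)
compareₖ zeros mixed = inj₁ zeros<mixed
compareₖ zeros ones  = inj₁ zeros<ones
compareₖ mixed zeros = inj₂ (inj₂ zeros<mixed)
compareₖ mixed mixed = inj₂ (inj₁ refl)
compareₖ mixed ones  = inj₁ mixed<ones
compareₖ ones  zeros = inj₂ (inj₂ zeros<ones)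
compareₖ ones  mixed = inj₂ (inj₂ mixed<ones)
compareₖ ones  ones  = inj₂ (inj₁ refl)

<ₖ-trans : i <ₖ j → j <ₖ k → i <ₖ k
<ₖ-trans zeros<mixed mixed<ones = zeros<ones
<ₖ-trans zeros<ones  ()
<ₖ-trans mixed<ones  ()

≤ₖ-trans : i ≤ₖ j → j ≤ₖ k → i ≤ₖ k
≤ₖ-trans = ReflClosure.trans <ₖ-trans

zeros≤ₖ : ∀ k → zeros ≤ₖ k
zeros≤ₖ zeros = refl
zeros≤ₖ mixed = [ zeros<mixed ]
zeros≤ₖ ones  = [ zeros<ones ]

data Run : Kind → Word → Set where
  [0]     : Run zeros (false ∷ [])
  0∷zeros : Run zeros w → Run zeros (false ∷ w)
  [1]     : Run ones (true ∷ [])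
  1∷ones  : Run ones w → Run ones (true ∷ w)
  0∷ones  : Run ones w → Run mixed (false ∷ w)
  0∷mixed : Run mixed w → Run mixed (false ∷ w)

countMixed : Kind → ℕ
countMixed mixed = 1
countMixed _     = 0

lastLetter : Kind → Bool
lastLetter zeros = false
lastLetter _     = true

lexLeq-<ₖ : ∀ {v} → Run j u → Run k v → j <ₖ k → lexLeq u v ≡ true
lexLeq-<ₖ [0]           (0∷ones _)   zeros<mixed = refl
lexLeq-<ₖ [0]           (0∷mixed _)  zeros<mixed = refl
lexLeq-<ₖ (0∷zeros r)   (0∷ones s)   zeros<mixed = lexLeq-<ₖ r s zeros<ones
lexLeq-<ₖ (0∷zeros r)   (0∷mixed s)  zeros<mixed = lexLeq-<ₖ r s zeros<mixed
lexLeq-<ₖ [0]           [1]          zeros<ones  = refl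
lexLeq-<ₖ [0]           (1∷ones _)   zeros<ones  = refl
lexLeq-<ₖ (0∷zeros _)   [1]          zeros<ones  = refl
lexLeq-<ₖ (0∷zeros _)   (1∷ones _)   zeros<ones  = refl
lexLeq-<ₖ (0∷ones _)    [1]          mixed<ones  = refl
lexLeq-<ₖ (0∷ones _)    (1∷ones _)   mixed<ones  = refl
lexLeq-<ₖ (0∷mixed _)   [1]          mixed<ones  = refl
lexLeq-<ₖ (0∷mixed _)   (1∷ones _)   mixed<ones  = refl

lexLeq->ₖ : ∀ {v} → Run j u → Run k v → k <ₖ j → lexLeq u v ≡ false
lexLeq->ₖ (0∷ones [1])             [0]         zeros<mixed = refl
lexLeq->ₖ (0∷ones (1∷ones _))      [0]         zeros<mixed = refl
lexLeq->ₖ (0∷mixed (0∷ones _))     [0]         zeros<mixed = refl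
lexLeq->ₖ (0∷mixed (0∷mixed _))    [0]         zeros<mixed = refl
lexLeq->ₖ (0∷ones r)               (0∷zeros s) zeros<mixed = lexLeq->ₖ r s zeros<ones
lexLeq->ₖ (0∷mixed r)              (0∷zeros s) zeros<mixed = lexLeq->ₖ r s zeros<mixed
lexLeq->ₖ [1]                      [0]         zeros<ones  = refl
lexLeq->ₖ [1]                      (0∷zeros _) zeros<ones  = refl
lexLeq->ₖ (1∷ones _)               [0]         zeros<ones  = refl
lexLeq->ₖ (1∷ones _)               (0∷zeros _) zeros<ones  = refl
lexLeq->ₖ [1]                      (0∷ones _)  mixed<ones  = refl
lexLeq->ₖ [1]                      (0∷mixed _) mixed<ones  = refl
lexLeq->ₖ (1∷ones _)               (0∷ones _)  mixed<ones  = refl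
lexLeq->ₖ (1∷ones _)               (0∷mixed _) mixed<ones  = refl

data Runs : ℕ → List Word → Set where
  []  : Runs 0 []
  _∷_ : Run k u → Runs m us → Runs (countMixed k + m) (u ∷ us)

-- The Kind index is a lower bound for the kinds of the runs, which are non-decreasing.
data SortedRuns : Kind → ℕ → List Word → Set where
  []   : SortedRuns i 0 []
  cons : i ≤ₖ k → Run k u → SortedRuns k m us → SortedRuns i (countMixed k + m) (u ∷ us)

insertLex-sorted : i ≤ₖ k → Run k u → SortedRuns i m L → SortedRuns i (countMixed k + m) (insertLex u L)
insertLex-sorted i≤k r [] = cons i≤k r []
insertLex-sorted {i} {k} {u} i≤k r (cons {k = l} {u = v} {m = m} {us} i≤l s ss) with compareₖ k l
... | inj₁ k<l rewrite lexLeq-<ₖ r s k<l = cons i≤k r (cons [ k<l ] s ss)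
... | inj₂ (inj₂ l<k) rewrite lexLeq->ₖ r s l<k =
  subst (λ n → SortedRuns i n (v ∷ insertLex u us)) (x∙yz≈y∙xz (countMixed l) (countMixed k) m)
        (cons i≤l s (insertLex-sorted [ l<k ] r ss))
... | inj₂ (inj₁ refl) with lexLeq u v
...   | true  = cons i≤k r (cons refl s ss)
...   | false = cons i≤l s (insertLex-sorted refl r ss)

sortLex-sorted : Runs m L → SortedRuns zeros m (sortLex L)
sortLex-sorted []       = []
sortLex-sorted (r ∷ rs) = insertLex-sorted (zeros≤ₖ _) r (sortLex-sorted rs)

des-false∷ : ∀ w → des (false ∷ w) ≡ des w
des-false∷ []      = refl
des-false∷ (y ∷ w) = refl

des-run++ : Run k u → ∀ w → des (u ++ w) ≡ des (lastLetter k ∷ w)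
des-run++ [0]                  w = refl
des-run++ (0∷zeros {u} r)      w = trans (des-false∷ (u ++ w)) (des-run++ r w)
des-run++ [1]                  w = refl
des-run++ (1∷ones [1])         w = refl
des-run++ (1∷ones r@(1∷ones _)) w = des-run++ r w
des-run++ (0∷ones {u} r)       w = trans (des-false∷ (u ++ w)) (des-run++ r w)
des-run++ (0∷mixed {u} r)      w = trans (des-false∷ (u ++ w)) (des-run++ r w)

des-true∷run++ : mixed ≤ₖ k → Run k u → ∀ w → des (true ∷ u ++ w) ≡ countMixed k + des (true ∷ w)
des-true∷run++ _ r@(0∷ones _)  w = cong suc (des-run++ r w)
des-true∷run++ _ r@(0∷mixed _) w = cong suc (des-run++ r w)
des-true∷run++ _ [1]           w = refl
des-true∷run++ _ r@(1∷ones _)  w = des-run++ r w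
des-true∷run++ [ () ] [0]         w
des-true∷run++ [ () ] (0∷zeros _) w

SortedRuns-ones-countMixed : SortedRuns ones m L → m ≡ 0
SortedRuns-ones-countMixed []              = refl
SortedRuns-ones-countMixed (cons refl _ s) = SortedRuns-ones-countMixed s

des-true∷concat : mixed ≤ₖ i → SortedRuns i m L → des (true ∷ concat L) ≡ m
des-true∷concat _ [] = refl
des-true∷concat mixed≤i (cons {k = k} {us = us} i≤k r s) =
  trans (des-true∷run++ mixed≤k r (concat us)) (cong (countMixed k +_) (des-true∷concat mixed≤k s))
  where
  mixed≤k : mixed ≤ₖ k
  mixed≤k = ≤ₖ-trans mixed≤i i≤k

des-concat-sorted : SortedRuns zeros m L → des (concat L) ≡ m ∸ 1
des-concat-sorted [] = refl
des-concat-sorted (cons {us = us} refl r s) =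
  trans (des-run++ r (concat us)) (trans (des-false∷ (concat us)) (des-concat-sorted s))
des-concat-sorted (cons {us = us} [ zeros<mixed ] r s) =
  trans (des-run++ r (concat us)) (des-true∷concat refl s)
des-concat-sorted (cons {us = us} [ zeros<ones ] r s) =
  trans (des-run++ r (concat us)) (trans (des-true∷concat [ mixed<ones ] s) (trans m≡0 (cong (_∸ 1) (sym m≡0))))
  where m≡0 = SortedRuns-ones-countMixed s

data RunsFrom : Bool → ℕ → List Word → Set where
  _∷_ : ∀ {r} → Run k (x ∷ r) → Runs m us → RunsFrom x (countMixed k + m) ((x ∷ r) ∷ us)

RunsFrom⇒Runs : RunsFrom x m L → Runs m L
RunsFrom⇒Runs (r ∷ rs) = r ∷ rs

attach-runs : ∀ x y w → RunsFrom y m L → RunsFrom x (ascent x y + m) (attach x (y ∷ w) L)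
attach-runs false false w ([0] ∷ rs)         = 0∷zeros [0] ∷ rs
attach-runs false false w (r@(0∷zeros _) ∷ rs) = 0∷zeros r ∷ rs
attach-runs false false w (r@(0∷ones _) ∷ rs)  = 0∷mixed r ∷ rs
attach-runs false false w (r@(0∷mixed _) ∷ rs) = 0∷mixed r ∷ rs
attach-runs false true  w (r@[1] ∷ rs)         = 0∷ones r ∷ rs
attach-runs false true  w (r@(1∷ones _) ∷ rs)  = 0∷ones r ∷ rs
attach-runs true  false w (r ∷ rs)             = [1] ∷ (r ∷ rs)
attach-runs true  true  w (r@[1] ∷ rs)         = 1∷ones r ∷ rs
attach-runs true  true  w (r@(1∷ones _) ∷ rs)  = 1∷ones r ∷ rs

runs-RunsFrom : ∀ x w → RunsFrom x (asc (x ∷ w)) (runs (x ∷ w))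
runs-RunsFrom false []      = [0] ∷ []
runs-RunsFrom true  []      = [1] ∷ []
runs-RunsFrom x     (y ∷ w) = attach-runs x y w (runs-RunsFrom y w)

runs-Runs : ∀ w → Runs (asc w) (runs w)
runs-Runs []      = []
runs-Runs (x ∷ w) = RunsFrom⇒Runs (runs-RunsFrom x w)

des-runsort : ∀ w → des (runsort w) ≡ asc w ∸ 1
des-runsort w = des-concat-sorted (sortLex-sorted (runs-Runs w))

sum-allWords-suc : ∀ n (h : Word → ℕ) →
  sum (map h (allWords (suc n))) ≡ sum (map (h ∘ (false ∷_)) (allWords n)) + sum (map (h ∘ (true ∷_)) (allWords n))
sum-allWords-suc n h = begin
  sum (map h (map (false ∷_) W ++ map (true ∷_) W))        ≡⟨ cong sum (map-++ h (map (false ∷_) W) _) ⟩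
  sum (map h (map (false ∷_) W) ++ map h (map (true ∷_) W)) ≡⟨ sum-++ (map h (map (false ∷_) W)) _ ⟩
  sum (map h (map (false ∷_) W)) + sum (map h (map (true ∷_) W))
    ≡⟨ cong₂ _+_ (cong sum (sym (map-∘ W))) (cong sum (sym (map-∘ W))) ⟩
  sum (map (h ∘ (false ∷_)) W) + sum (map (h ∘ (true ∷_)) W) ∎
  where
  open ≡-Reasoning
  W = allWords n

sum-applyUpTo-cong : ∀ {f g : ℕ → ℕ} → f ≗ g → ∀ N → sum (applyUpTo f N) ≡ sum (applyUpTo g N)
sum-applyUpTo-cong f≗g zero    = refl
sum-applyUpTo-cong f≗g (suc N) = cong₂ _+_ (f≗g 0) (sum-applyUpTo-cong (f≗g ∘ suc) N)

sum-applyUpTo-+ : ∀ (f g : ℕ → ℕ) N →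
  sum (applyUpTo (λ j → f j + g j) N) ≡ sum (applyUpTo f N) + sum (applyUpTo g N)
sum-applyUpTo-+ f g zero    = refl
sum-applyUpTo-+ f g (suc N) =
  trans (cong (f 0 + g 0 +_) (sum-applyUpTo-+ (f ∘ suc) (g ∘ suc) N)) (interchange (f 0) (g 0) _ _)

sum-applyUpTo-suc : ∀ (f : ℕ → ℕ) N → f N ≡ 0 → sum (applyUpTo f (suc N)) ≡ sum (applyUpTo f N)
sum-applyUpTo-suc f zero    fN≡0 = trans (+-identityʳ (f 0)) fN≡0
sum-applyUpTo-suc f (suc N) fN≡0 = cong (f 0 +_) (sum-applyUpTo-suc (f ∘ suc) N fN≡0)

sum-applyUpTo-zero : ∀ N → sum (applyUpTo (λ _ → 0) N) ≡ 0
sum-applyUpTo-zero zero    = refl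
sum-applyUpTo-zero (suc N) = sum-applyUpTo-zero N

map-range : ∀ (h : ℕ → A) a b → map h (range a b) ≡ applyUpTo (λ i → h (a + i)) (suc b ∸ a)
map-range h a b = trans (cong (map h) (map-upTo (a +_) (suc b ∸ a))) (map-applyUpTo (a +_) h (suc b ∸ a))

length-filter-≟0 : ∀ (f : A → ℕ) xs → length (filter (λ x → f x ≟ 0) xs) ≡ sum (map (λ x → 0 ^ f x) xs)
length-filter-≟0 f []       = refl
length-filter-≟0 f (x ∷ xs) with f x
... | zero  = cong suc (length-filter-≟0 f xs)
... | suc _ = length-filter-≟0 f xs

-- The weight g is arbitrary so that the induction step for 0∷1∷w can absorb the new factor 01
-- into g ∘ suc.
sum-asc : ∀ n (g : ℕ → ℕ) →
  sum (map (g ∘ asc) (allWords n)) ≡ sum (applyUpTo (λ j → g j * (suc n C suc (2 * j))) (suc n))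
sum-asc-false∷ : ∀ n (g : ℕ → ℕ) →
  sum (map (g ∘ asc ∘ (false ∷_)) (allWords n)) ≡ sum (applyUpTo (λ j → g j * (suc n C (2 * j))) (suc n))

sum-asc zero g = cong (_+ 0) (sym (*-identityʳ (g 0)))
sum-asc (suc n) g = begin
  sum (map (g ∘ asc) (allWords (suc n)))
    ≡⟨ sum-allWords-suc n (g ∘ asc) ⟩
  sum (map (g ∘ asc ∘ (false ∷_)) W) + sum (map (g ∘ asc ∘ (true ∷_)) W)
    ≡⟨ cong₂ _+_ refl (cong sum (map-cong (cong g ∘ asc-true∷) W)) ⟩
  sum (map (g ∘ asc ∘ (false ∷_)) W) + sum (map (g ∘ asc) W)
    ≡⟨ cong₂ _+_ (sum-asc-false∷ n g) (sum-asc n g) ⟩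
  sum (applyUpTo even (suc n)) + sum (applyUpTo odd (suc n))
    ≡⟨ sym (sum-applyUpTo-+ even odd (suc n)) ⟩
  sum (applyUpTo (λ j → even j + odd j) (suc n))
    ≡⟨ sum-applyUpTo-cong pascal (suc n) ⟩
  sum (applyUpTo f (suc n))
    ≡⟨ sym (sum-applyUpTo-suc f (suc n) vanish) ⟩
  sum (applyUpTo f (suc (suc n))) ∎
  where
  open ≡-Reasoning
  W = allWords n
  even odd f : ℕ → ℕ
  even j = g j * (suc n C (2 * j))
  odd  j = g j * (suc n C suc (2 * j))
  f    j = g j * (suc (suc n) C suc (2 * j))
  pascal : ∀ j → even j + odd j ≡ f j
  pascal j = trans (sym (*-distribˡ-+ (g j) _ _)) (cong (g j *_) (nCk+nC[k+1]≡[n+1]C[k+1] (suc n) (2 * j)))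
  vanish : f (suc n) ≡ 0
  vanish = trans (cong (g (suc n) *_) (k>n⇒nCk≡0 (s≤s (m<m+n (suc n) (s≤s z≤n))))) (*-zeroʳ (g (suc n)))

sum-asc-false∷ zero g = cong (_+ 0) (sym (*-identityʳ (g 0)))
sum-asc-false∷ (suc n) g = begin
  sum (map (g ∘ asc ∘ (false ∷_)) (allWords (suc n)))
    ≡⟨ sum-allWords-suc n (g ∘ asc ∘ (false ∷_)) ⟩
  sum (map (g ∘ asc ∘ (false ∷_)) W) + sum (map (g ∘ suc ∘ asc ∘ (true ∷_)) W)
    ≡⟨ cong₂ _+_ refl (cong sum (map-cong (cong (g ∘ suc) ∘ asc-true∷) W)) ⟩
  sum (map (g ∘ asc ∘ (false ∷_)) W) + sum (map (g ∘ suc ∘ asc) W)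
    ≡⟨ cong₂ _+_ (sum-asc-false∷ n g) (sum-asc n (g ∘ suc)) ⟩
  (g 0 * 1 + sum (applyUpTo even n)) + sum (applyUpTo odd (suc n))
    ≡⟨ cong₂ _+_ (cong (g 0 * 1 +_) (sym (sum-applyUpTo-suc even n vanish))) refl ⟩
  (g 0 * 1 + Σeven) + Σodd
    ≡⟨ trans (+-assoc (g 0 * 1) Σeven Σodd) (cong (g 0 * 1 +_) (+-comm Σeven Σodd)) ⟩
  g 0 * 1 + (Σodd + Σeven)
    ≡⟨ cong (g 0 * 1 +_) (sym (sum-applyUpTo-+ odd even (suc n))) ⟩
  g 0 * 1 + sum (applyUpTo (λ j → odd j + even j) (suc n))
    ≡⟨ cong (g 0 * 1 +_) (sum-applyUpTo-cong pascal (suc n)) ⟩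
  sum (applyUpTo (λ j → g j * (suc (suc n) C (2 * j))) (suc (suc n))) ∎
  where
  open ≡-Reasoning
  W = allWords n
  odd even : ℕ → ℕ
  odd  j = g (suc j) * (suc n C suc (2 * j))
  even j = g (suc j) * (suc n C (2 * suc j))
  Σodd Σeven : ℕ
  Σodd  = sum (applyUpTo odd (suc n))
  Σeven = sum (applyUpTo even (suc n))
  vanish : even n ≡ 0
  vanish = trans (cong (g (suc n) *_) (k>n⇒nCk≡0 (m<m+n (suc n) (s≤s z≤n)))) (*-zeroʳ (g (suc n)))
  pascal : ∀ j → odd j + even j ≡ g (suc j) * (suc (suc n) C (2 * suc j))
  pascal j = begin
    odd j + even j
      ≡⟨ cong (λ i → odd j + g (suc j) * (suc n C i)) (*-suc 2 j) ⟩
    g (suc j) * (suc n C suc (2 * j)) + g (suc j) * (suc n C suc (suc (2 * j)))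
      ≡⟨ sym (*-distribˡ-+ (g (suc j)) _ _) ⟩
    g (suc j) * (suc n C suc (2 * j) + suc n C suc (suc (2 * j)))
      ≡⟨ cong (g (suc j) *_) (nCk+nC[k+1]≡[n+1]C[k+1] (suc n) (suc (2 * j))) ⟩
    g (suc j) * (suc (suc n) C suc (suc (2 * j)))
      ≡⟨ cong (λ i → g (suc j) * (suc (suc n) C i)) (sym (*-suc 2 j)) ⟩
    g (suc j) * (suc (suc n) C (2 * suc j)) ∎

Cpoly-closed : ∀ m t → Cpoly (suc m) t ≡ ((suc (suc m)) C 3 + suc (suc m))
  + sum (map (λ k → t ^ (k ∸ 1) * (suc m C (2 * k) + suc m C (2 * k + 1))) (range 2 (suc m)))
Cpoly-closed m t = begin
  Cpoly n t
    ≡⟨ cong sum (map-cong (cong (t ^_) ∘ des-runsort) (allWords n)) ⟩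
  sum (map (λ w → t ^ (asc w ∸ 1)) (allWords n))
    ≡⟨ sum-asc n (λ j → t ^ (j ∸ 1)) ⟩
  f 0 + (f 1 + sum (applyUpTo (f ∘ (2 +_)) m))
    ≡⟨ sym (+-assoc (f 0) (f 1) _) ⟩
  f 0 + f 1 + sum (applyUpTo (f ∘ (2 +_)) m)
    ≡⟨ cong₂ _+_ first-terms (sum-applyUpTo-cong (pascal ∘ (2 +_)) m) ⟩
  (suc n C 3 + suc n) + sum (applyUpTo (h ∘ (2 +_)) m)
    ≡⟨ cong (suc n C 3 + suc n +_) (cong sum (sym (map-range h 2 n))) ⟩
  (suc n C 3 + suc n) + sum (map h (range 2 n)) ∎
  where
  open ≡-Reasoning
  n = suc m
  f h : ℕ → ℕ
  f k = t ^ (k ∸ 1) * (suc n C suc (2 * k))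
  h k = t ^ (k ∸ 1) * (n C (2 * k) + n C (2 * k + 1))
  first-terms : f 0 + f 1 ≡ suc n C 3 + suc n
  first-terms = trans (cong₂ _+_ (trans (*-identityˡ _) (nC1≡n (suc n))) (*-identityˡ _)) (+-comm (suc n) _)
  pascal : ∀ k → f k ≡ h k
  pascal k = cong (t ^ (k ∸ 1) *_) (sym (trans (cong (λ i → n C (2 * k) + n C i) (+-comm (2 * k) 1))
                                                (nCk+nC[k+1]≡[n+1]C[k+1] n (2 * k))))

theorem5p10 : (n : ℕ) → n ≥ 1 →
    ((t : ℕ) → Cpoly n t ≡ ((suc n) C 3 + suc n)
    + sum (map (λ k → t ^ (k ∸ 1) * (n C (2 * k) + n C (2 * k + 1))) (range 2 n)))
    × (length (filter (λ w → des (runsort w) ≟ 0) (allWords n)) ≡ (suc n) C 3 + n + 1)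
theorem5p10 (suc m) _ = Cpoly-closed m , (begin
  length (filter (λ w → des (runsort w) ≟ 0) (allWords n))
    ≡⟨ length-filter-≟0 (des ∘ runsort) (allWords n) ⟩
  Cpoly n 0
    ≡⟨ Cpoly-closed m 0 ⟩
  suc n C 3 + suc n + sum (map (λ k → 0 ^ (k ∸ 1) * (n C (2 * k) + n C (2 * k + 1))) (range 2 n))
    ≡⟨ cong (suc n C 3 + suc n +_) (trans (cong sum (map-range _ 2 n)) (sum-applyUpTo-zero m)) ⟩
  suc n C 3 + suc n + 0
    ≡⟨ trans (+-identityʳ _) (trans (cong (suc n C 3 +_) (+-comm 1 n)) (sym (+-assoc (suc n C 3) n 1))) ⟩
  suc n C 3 + n + 1 ∎)
  where
  open ≡-Reasoning
  n = suc m
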